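{- Let $\Gamma$ be the context $x_1:\mathbb N,\dots,x_m:\mathbb N,X_1:\mathrm{Set}(\mathbb N),\dots,X_n:\mathrm{Set}(\mathbb N)$ and let $\phi$ be a formula of $\mathcal L$ with free variables among $x_1,\dots,x_m,X_1,\dots,X_n$. If $\mathrm{ACA}_0\vdash\phi$, then $\Gamma\vdash\ \Rightarrow\langle\phi\rangle$ is derivable in $\mathrm{T}_2$.
   Context: Second order arithmetic. The language $\mathcal L$ has number variables $x,y,z,\dots$ and set variables $X,Y,Z,\dots$; terms $t::=x\mid 0\mid \mathrm S t\mid t+t\mid t\cdot t$; formulas $\phi::=t=t\mid t\in X\mid\bot\mid\phi\supset\phi\mid\forall x\phi\mid\forall X\phi$, other connectives defined classically. A formula is arithmetic if it contains no set quantifier. $\mathrm{ACA}_0$ is the classical two-sorted theory with equality with axioms: $\mathrm Sx\neq0$; $\mathrm Sx=\mathrm Sy\supset x=y$; $x+0=x$; $x+\mathrm Sy=\mathrm S(x+y)$; $x\cdot0=0$; $x\cdot\mathrm Sy=x\cdot y+x$; $\exists X\forall x(x\in X\leftrightarrow\phi)$ for each arithmetic $\phi$ not containing $X$ free; $0\in X\supset\forall x(x\in X\supset\mathrm Sx\in X)\supset\forall x.\,x\in X$. The logic-enriched type theory $\mathrm{T}_2$. Types: $\mathbb N$ and $\mathrm{Set}(\mathbb N)$. Terms: $M::=x\mid0\mid\mathrm sM\mid\mathrm R(M,[x,y]M,M)\mid\{x:\mathbb N\mid P\}$. Small propositions: $P::=M\mathbin{\hat=}_{\mathbb N}M\mid\hat\bot\mid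 P\mathbin{\hat\supset}P\mid\hat\forall x{:}\hat{\mathbb N}.P\mid M\mathbin{\hat\in}_{\mathbb N}M$. Propositions: $\phi::=M=_{\mathbb N}M\mid\bot\mid\phi\supset\phi\mid\forall x{:}A.\phi\mid V(P)$ ($A$ a type). Abbreviations $\neg\phi:=\phi\supset\bot$, classical $\wedge,\vee,\leftrightarrow,\exists$, $M\in_{\mathbb N}N:=V(M\mathbin{\hat\in}_{\mathbb N}N)$, hatted analogues. Judgements $\Gamma\vdash\mathcal J$ for $\mathcal J$ among $\mathrm{valid}$, $A$ type, $A=B$, $M:A$, $M=N:A$, $P$ prop, $P=Q$, $\phi$ Prop, $\phi=\psi$, $\phi_1,\dots,\phi_n\Rightarrow\psi$. Rules: standard structural rules (context formation, variables, judgemental equalities are equivalences, transfer along type equality, $\Gamma\vdash\phi_1,\dots,\phi_n\Rightarrow\phi_i$, replacement of an entailed proposition by an equal one); congruence rules for all constructors; $0:\mathbb N$, $\mathrm sM:\mathbb N$; if $\Gamma\vdash L:\mathbb N$, $\Gamma,x{:}\mathbb N,y{:}\mathbb N\vdash M:\mathbb N$, $\Gamma\vdash N:\mathbb N$ then $\mathrm R(L,[x,y]M,N):\mathbb N$, with $\mathrm R(L,[x,y]M,0)=L$ and $\mathrm R(L,[x,y]M,\mathrm sN)=[N/x,\mathrm R(L,[x,y]M,N)/y]M$; $\{x:\mathbb N\mid P\}:\mathrm{Set}(\mathbb N)$ when $\Gamma,x{:}\mathbb N\vdash P$ prop; $M\mathbin{\hat\in}_{\mathbb N}N$ prop for $M:\mathbb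 N,N:\mathrm{Set}(\mathbb N)$, with $(M\mathbin{\hat\in}_{\mathbb N}\{x:\mathbb N\mid P\})=[M/x]P$; $V(P)$ Prop for $P$ prop; $V(\hat\bot)=\bot$; $V(P\mathbin{\hat\supset}Q)=V(P)\supset V(Q)$; $\hat\forall x{:}\hat{\mathbb N}.P$ prop with $V(\hat\forall x{:}\hat{\mathbb N}.P)=\forall x{:}\mathbb N.V(P)$ when $\Gamma,x{:}\mathbb N\vdash P$ prop; $M_1=_{\mathbb N}M_2$ Prop, $M_1\mathbin{\hat=}_{\mathbb N}M_2$ prop and $V(M_1\mathbin{\hat=}_{\mathbb N}M_2)=(M_1=_{\mathbb N}M_2)$ for $M_i:\mathbb N$; classical predicate logic ($\bot$-elim, $\supset$ intro/elim, double negation elimination, $\forall$ intro/elim); reflexivity $\Phi\Rightarrow M=_{\mathbb N}M$ and substitution (from $\Gamma,x{:}\mathbb N\vdash\phi$ Prop, $\Phi\Rightarrow M_1=_{\mathbb N}M_2$, $\Phi\Rightarrow[M_1/x]\phi$ infer $\Phi\Rightarrow[M_2/x]\phi$); induction only for small propositions: from $\Gamma,x{:}\mathbb N\vdash P$ prop, $\Gamma\vdash N:\mathbb N$, $\Gamma\vdash\Phi\Rightarrow V([0/x]P)$, $\Gamma,x{:}\mathbb N\vdash\Phi,V(P)\Rightarrow V([\mathrm sx/x]P)$ infer $\Gamma\vdash\Phi\Rightarrow V([N/x]P)$; and the axiom $\Gamma\vdash\phi_1,\dots,\phi_n\Rightarrow\neg(0=_{\mathbb N}\mathrm sM)$ for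 $\Gamma\vdash M:\mathbb N$. Translation: $\langle x\rangle\equiv x$, $\langle0\rangle\equiv0$, $\langle\mathrm St\rangle\equiv\mathrm s\langle t\rangle$, $\langle s+t\rangle\equiv\langle s\rangle\ \mathtt{plus}\ \langle t\rangle$, $\langle s\cdot t\rangle\equiv\langle s\rangle\ \mathtt{times}\ \langle t\rangle$ with $M\ \mathtt{plus}\ N\equiv\mathrm R(M,[x,y]\mathrm sy,N)$, $M\ \mathtt{times}\ N\equiv\mathrm R(0,[x,y]\,y\ \mathtt{plus}\ M,N)$; $\langle s=t\rangle\equiv\langle s\rangle=_{\mathbb N}\langle t\rangle$, $\langle t\in X\rangle\equiv\langle t\rangle\in_{\mathbb N}X$, $\langle\neg\phi\rangle\equiv\neg\langle\phi\rangle$, $\langle\phi\supset\psi\rangle\equiv\langle\phi\rangle\supset\langle\psi\rangle$, $\langle\forall x\phi\rangle\equiv\forall x{:}\mathbb N.\langle\phi\rangle$, $\langle\forall X\phi\rangle\equiv\forall X{:}\mathrm{Set}(\mathbb N).\langle\phi\rangle$. -}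

module Defs where

open import Data.Nat using (ℕ; zero; suc)
open import Data.Fin using (Fin; zero; suc)
open import Data.List using (List; []; _∷_; map)
open import Data.List.Membership.Propositional using (_∈_)

-- Index zero is the most recently bound variable.

data Term (m : ℕ) : Set where
  avar : Fin m → Term m
  `0   : Term m
  `S   : Term m → Term m
  _`+_ : Term m → Term m → Term m
  _`·_ : Term m → Term m → Term m

infix  6 _`≡_ _`∈_
infixr 4 _`⊃_

data Form (m n : ℕ) : Set where
  _`≡_ : Term m → Term m → Form m n
  _`∈_ : Term m → Fin n → Form m n
  `⊥   : Form m n
  _`⊃_ : Form m n → Form m n → Form m n
  `∀   : Form (suc m) n → Form m n
  `∀²  : Form m (suc n) → Form m n

`¬_ : ∀ {m n} → Form m n → Form m n
`¬ φ = φ `⊃ `⊥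

_`∧_ : ∀ {m n} → Form m n → Form m n → Form m n
φ `∧ ψ = `¬ (φ `⊃ `¬ ψ)

_`↔_ : ∀ {m n} → Form m n → Form m n → Form m n
φ `↔ ψ = (φ `⊃ ψ) `∧ (ψ `⊃ φ)

`∃² : ∀ {m n} → Form m (suc n) → Form m n
`∃² φ = `¬ `∀² (`¬ φ)

renT : ∀ {m m'} → (Fin m → Fin m') → Term m → Term m'
renT ρ (avar i) = avar (ρ i)
renT ρ `0 = `0
renT ρ (`S t) = `S (renT ρ t)
renT ρ (s `+ t) = renT ρ s `+ renT ρ t
renT ρ (s `· t) = renT ρ s `· renT ρ t

subT : ∀ {m m'} → (Fin m → Term m') → Term m → Term m'
subT σ (avar i) = σ i
subT σ `0 = `0
subT σ (`S t) = `S (subT σ t)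
subT σ (s `+ t) = subT σ s `+ subT σ t
subT σ (s `· t) = subT σ s `· subT σ t

liftT : ∀ {m m'} → (Fin m → Term m') → Fin (suc m) → Term (suc m')
liftT σ zero = avar zero
liftT σ (suc i) = renT suc (σ i)

liftF : ∀ {n n'} → (Fin n → Fin n') → Fin (suc n) → Fin (suc n')
liftF τ zero = zero
liftF τ (suc j) = suc (τ j)

subF : ∀ {m m' n n'} → (Fin m → Term m') → (Fin n → Fin n') → Form m n → Form m' n'
subF σ τ (s `≡ t) = subT σ s `≡ subT σ t
subF σ τ (t `∈ X) = subT σ t `∈ τ X
subF σ τ `⊥ = `⊥
subF σ τ (φ `⊃ ψ) = subF σ τ φ `⊃ subF σ τ ψ
subF σ τ (`∀ φ) = `∀ (subF (liftT σ) τ φ)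
subF σ τ (`∀² φ) = `∀² (subF σ (liftF τ) φ)

wkN : ∀ {m n} → Form m n → Form (suc m) n
wkN = subF (λ i → avar (suc i)) (λ j → j)

wkS : ∀ {m n} → Form m n → Form m (suc n)
wkS = subF avar suc

_[_] : ∀ {m n} → Form (suc m) n → Term m → Form m n
φ [ t ] = subF σ (λ j → j) φ
  where σ : Fin (suc _) → Term _
        σ zero = t
        σ (suc i) = avar i

_[²_] : ∀ {m n} → Form m (suc n) → Fin n → Form m n
φ [² Y ] = subF avar τ φ
  where τ : Fin (suc _) → Fin _
        τ zero = Y
        τ (suc j) = j

data Arithmetic : ∀ {m n} → Form m n → Set where
  ar-eq  : ∀ {m n} {s t : Term m} → Arithmetic {m} {n} (s `≡ t)
  ar-mem : ∀ {m n} {t : Term m} {X : Fin n} → Arithmetic (t `∈ X)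
  ar-bot : ∀ {m n} → Arithmetic {m} {n} `⊥
  ar-imp : ∀ {m n} {φ ψ : Form m n} → Arithmetic φ → Arithmetic ψ → Arithmetic (φ `⊃ ψ)
  ar-all : ∀ {m n} {φ : Form (suc m) n} → Arithmetic φ → Arithmetic (`∀ φ)

-- the axioms of ACA₀ (the open axioms are given by their universal closures)
x₀ x₁ : ∀ {m} → Term (suc (suc m))
x₀ = avar zero
x₁ = avar (suc zero)

data Axiom : ∀ {m n} → Form m n → Set where
  ax-S≢0   : ∀ {m n} → Axiom {m} {n} (`∀ (`¬ (`S (avar zero) `≡ `0)))
  ax-Sinj  : ∀ {m n} → Axiom {m} {n} (`∀ (`∀ (`S x₁ `≡ `S x₀ `⊃ x₁ `≡ x₀)))
  ax-+0    : ∀ {m n} → Axiom {m} {n} (`∀ ((avar zero `+ `0) `≡ avar zero))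
  ax-+S    : ∀ {m n} → Axiom {m} {n} (`∀ (`∀ ((x₁ `+ `S x₀) `≡ `S (x₁ `+ x₀))))
  ax-·0    : ∀ {m n} → Axiom {m} {n} (`∀ ((avar zero `· `0) `≡ `0))
  ax-·S    : ∀ {m n} → Axiom {m} {n} (`∀ (`∀ ((x₁ `· `S x₀) `≡ ((x₁ `· x₀) `+ x₁))))
  -- ∃X ∀x (x ∈ X ↔ φ), φ arithmetic, X not free in φ (φ is weakened past X)
  ax-comp  : ∀ {m n} (φ : Form (suc m) n) → Arithmetic φ →
             Axiom (`∃² (`∀ ((avar zero `∈ zero) `↔ wkS φ)))
  ax-ind   : ∀ {m n} → Axiom {m} {n}
             (`∀² ((`0 `∈ zero) `⊃ `∀ ((avar zero `∈ zero) `⊃ (`S (avar zero) `∈ zero))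
                    `⊃ `∀ (avar zero `∈ zero)))

infix 2 _⊢ᴬ_
data _⊢ᴬ_ : ∀ {m n} → List (Form m n) → Form m n → Set where
  hyp   : ∀ {m n} {Δ : List (Form m n)} {φ} → φ ∈ Δ → Δ ⊢ᴬ φ
  ax    : ∀ {m n} {Δ : List (Form m n)} {φ} → Axiom φ → Δ ⊢ᴬ φ
  ⊥E    : ∀ {m n} {Δ : List (Form m n)} {φ} → Δ ⊢ᴬ `⊥ → Δ ⊢ᴬ φ
  ⊃I    : ∀ {m n} {Δ : List (Form m n)} {φ ψ} → (φ ∷ Δ) ⊢ᴬ ψ → Δ ⊢ᴬ φ `⊃ ψ
  ⊃E    : ∀ {m n} {Δ : List (Form m n)} {φ ψ} → Δ ⊢ᴬ φ `⊃ ψ → Δ ⊢ᴬ φ → Δ ⊢ᴬ ψ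
  dne   : ∀ {m n} {Δ : List (Form m n)} {φ} → Δ ⊢ᴬ `¬ `¬ φ → Δ ⊢ᴬ φ
  ∀I    : ∀ {m n} {Δ : List (Form m n)} {φ} → map wkN Δ ⊢ᴬ φ → Δ ⊢ᴬ `∀ φ
  ∀E    : ∀ {m n} {Δ : List (Form m n)} {φ} → Δ ⊢ᴬ `∀ φ → (t : Term m) → Δ ⊢ᴬ φ [ t ]
  ∀²I   : ∀ {m n} {Δ : List (Form m n)} {φ} → map wkS Δ ⊢ᴬ φ → Δ ⊢ᴬ `∀² φ
  ∀²E   : ∀ {m n} {Δ : List (Form m n)} {φ} → Δ ⊢ᴬ `∀² φ → (Y : Fin n) → Δ ⊢ᴬ φ [² Y ]
  eqRefl  : ∀ {m n} {Δ : List (Form m n)} {t} → Δ ⊢ᴬ t `≡ t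
  eqSubst : ∀ {m n} {Δ : List (Form m n)} {s t} (φ : Form (suc m) n) →
            Δ ⊢ᴬ s `≡ t → Δ ⊢ᴬ φ [ s ] → Δ ⊢ᴬ φ [ t ]

ACA₀⊢ : ∀ {m n} → Form m n → Set
ACA₀⊢ φ = [] ⊢ᴬ φ

-- PART II.  The logic-enriched type theory T₂
-- Intrinsically typed/scoped syntax: Tm Γ A is a term M with Γ ⊢ M : A,
-- SP Γ a small proposition (Γ ⊢ P prop), Prp Γ a proposition (Γ ⊢ φ Prop).

data Ty : Set where
  Nat SetNat : Ty

infixl 5 _▸_
data Ctx : Set where
  ε   : Ctx
  _▸_ : Ctx → Ty → Ctx

infix 4 _∋_
data _∋_ : Ctx → Ty → Set where
  here  : ∀ {Γ A} → Γ ▸ A ∋ A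
  there : ∀ {Γ A B} → Γ ∋ A → Γ ▸ B ∋ A

infix 6 _=̂_ _∈̂_
infixr 4 _⊃̂_
mutual
  data Tm (Γ : Ctx) : Ty → Set where
    var  : ∀ {A} → Γ ∋ A → Tm Γ A
    zer  : Tm Γ Nat
    sc   : Tm Γ Nat → Tm Γ Nat
    R    : Tm Γ Nat → Tm (Γ ▸ Nat ▸ Nat) Nat → Tm Γ Nat → Tm Γ Nat
    cmp  : SP (Γ ▸ Nat) → Tm Γ SetNat

  data SP (Γ : Ctx) : Set where
    _=̂_ : Tm Γ Nat → Tm Γ Nat → SP Γ
    ⊥̂   : SP Γ
    _⊃̂_ : SP Γ → SP Γ → SP Γ
    ∀̂    : SP (Γ ▸ Nat) → SP Γ
    _∈̂_ : Tm Γ Nat → Tm Γ SetNat → SP Γ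

infix 6 _≐_
infixr 4 _⊃ᴾ_
data Prp (Γ : Ctx) : Set where
  _≐_  : Tm Γ Nat → Tm Γ Nat → Prp Γ
  ⊥ᴾ   : Prp Γ
  _⊃ᴾ_ : Prp Γ → Prp Γ → Prp Γ
  ∀ᴾ   : (A : Ty) → Prp (Γ ▸ A) → Prp Γ
  V    : SP Γ → Prp Γ

¬ᴾ_ : ∀ {Γ} → Prp Γ → Prp Γ
¬ᴾ φ = φ ⊃ᴾ ⊥ᴾ

Ren : Ctx → Ctx → Set
Ren Γ Δ = ∀ {A} → Γ ∋ A → Δ ∋ A

liftRen : ∀ {Γ Δ B} → Ren Γ Δ → Ren (Γ ▸ B) (Δ ▸ B)
liftRen ρ here = here
liftRen ρ (there x) = there (ρ x)

mutual
  renTm : ∀ {Γ Δ A} → Ren Γ Δ → Tm Γ A → Tm Δ A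
  renTm ρ (var x) = var (ρ x)
  renTm ρ zer = zer
  renTm ρ (sc M) = sc (renTm ρ M)
  renTm ρ (R L M N) = R (renTm ρ L) (renTm (liftRen (liftRen ρ)) M) (renTm ρ N)
  renTm ρ (cmp P) = cmp (renSP (liftRen ρ) P)

  renSP : ∀ {Γ Δ} → Ren Γ Δ → SP Γ → SP Δ
  renSP ρ (M =̂ N) = renTm ρ M =̂ renTm ρ N
  renSP ρ ⊥̂ = ⊥̂
  renSP ρ (P ⊃̂ Q) = renSP ρ P ⊃̂ renSP ρ Q
  renSP ρ (∀̂ P) = ∀̂ (renSP (liftRen ρ) P)
  renSP ρ (M ∈̂ N) = renTm ρ M ∈̂ renTm ρ N

renPrp : ∀ {Γ Δ} → Ren Γ Δ → Prp Γ → Prp Δ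
renPrp ρ (M ≐ N) = renTm ρ M ≐ renTm ρ N
renPrp ρ ⊥ᴾ = ⊥ᴾ
renPrp ρ (φ ⊃ᴾ ψ) = renPrp ρ φ ⊃ᴾ renPrp ρ ψ
renPrp ρ (∀ᴾ A φ) = ∀ᴾ A (renPrp (liftRen ρ) φ)
renPrp ρ (V P) = V (renSP ρ P)

Sub : Ctx → Ctx → Set
Sub Γ Δ = ∀ {A} → Γ ∋ A → Tm Δ A

liftSub : ∀ {Γ Δ B} → Sub Γ Δ → Sub (Γ ▸ B) (Δ ▸ B)
liftSub σ here = var here
liftSub σ (there x) = renTm there (σ x)

mutual
  subTm : ∀ {Γ Δ A} → Sub Γ Δ → Tm Γ A → Tm Δ A
  subTm σ (var x) = σ x
  subTm σ zer = zer
  subTm σ (sc M) = sc (subTm σ M)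
  subTm σ (R L M N) = R (subTm σ L) (subTm (liftSub (liftSub σ)) M) (subTm σ N)
  subTm σ (cmp P) = cmp (subSP (liftSub σ) P)

  subSP : ∀ {Γ Δ} → Sub Γ Δ → SP Γ → SP Δ
  subSP σ (M =̂ N) = subTm σ M =̂ subTm σ N
  subSP σ ⊥̂ = ⊥̂
  subSP σ (P ⊃̂ Q) = subSP σ P ⊃̂ subSP σ Q
  subSP σ (∀̂ P) = ∀̂ (subSP (liftSub σ) P)
  subSP σ (M ∈̂ N) = subTm σ M ∈̂ subTm σ N

subPrp : ∀ {Γ Δ} → Sub Γ Δ → Prp Γ → Prp Δ
subPrp σ (M ≐ N) = subTm σ M ≐ subTm σ N
subPrp σ ⊥ᴾ = ⊥ᴾ
subPrp σ (φ ⊃ᴾ ψ) = subPrp σ φ ⊃ᴾ subPrp σ ψ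
subPrp σ (∀ᴾ A φ) = ∀ᴾ A (subPrp (liftSub σ) φ)
subPrp σ (V P) = V (subSP σ P)

sub0 : ∀ {Γ A} → Tm Γ A → Sub (Γ ▸ A) Γ
sub0 M here = M
sub0 M (there x) = var x

-- [N/x, K/y] for the last two variables x, y (y last)
sub2 : ∀ {Γ} → Tm Γ Nat → Tm Γ Nat → Sub (Γ ▸ Nat ▸ Nat) Γ
sub2 N K here = K
sub2 N K (there here) = N
sub2 N K (there (there x)) = var x

subSucc : ∀ {Γ} → Sub (Γ ▸ Nat) (Γ ▸ Nat)
subSucc here = sc (var here)
subSucc (there x) = var (there x)

wkPrp : ∀ {Γ B} → Prp Γ → Prp (Γ ▸ B)
wkPrp = renPrp there

mutual
  data _≡Tm_ : ∀ {Γ A} → Tm Γ A → Tm Γ A → Set where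
    tm-refl  : ∀ {Γ A} {M : Tm Γ A} → M ≡Tm M
    tm-sym   : ∀ {Γ A} {M N : Tm Γ A} → M ≡Tm N → N ≡Tm M
    tm-trans : ∀ {Γ A} {M N K : Tm Γ A} → M ≡Tm N → N ≡Tm K → M ≡Tm K
    sc-cong  : ∀ {Γ} {M N : Tm Γ Nat} → M ≡Tm N → sc M ≡Tm sc N
    R-cong   : ∀ {Γ} {L L' N N' : Tm Γ Nat} {M M' : Tm (Γ ▸ Nat ▸ Nat) Nat} →
               L ≡Tm L' → M ≡Tm M' → N ≡Tm N' → R L M N ≡Tm R L' M' N'
    cmp-cong : ∀ {Γ} {P Q : SP (Γ ▸ Nat)} → P ≡SP Q → cmp P ≡Tm cmp Q
    R-zero   : ∀ {Γ} {L : Tm Γ Nat} {M : Tm (Γ ▸ Nat ▸ Nat) Nat} → R L M zer ≡Tm L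
    R-suc    : ∀ {Γ} {L N : Tm Γ Nat} {M : Tm (Γ ▸ Nat ▸ Nat) Nat} →
               R L M (sc N) ≡Tm subTm (sub2 N (R L M N)) M

  data _≡SP_ : ∀ {Γ} → SP Γ → SP Γ → Set where
    sp-refl  : ∀ {Γ} {P : SP Γ} → P ≡SP P
    sp-sym   : ∀ {Γ} {P Q : SP Γ} → P ≡SP Q → Q ≡SP P
    sp-trans : ∀ {Γ} {P Q S : SP Γ} → P ≡SP Q → Q ≡SP S → P ≡SP S
    =̂-cong  : ∀ {Γ} {M M' N N' : Tm Γ Nat} → M ≡Tm M' → N ≡Tm N' → (M =̂ N) ≡SP (M' =̂ N')
    ⊃̂-cong  : ∀ {Γ} {P P' Q Q' : SP Γ} → P ≡SP P' → Q ≡SP Q' → (P ⊃̂ Q) ≡SP (P' ⊃̂ Q')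
    ∀̂-cong   : ∀ {Γ} {P Q : SP (Γ ▸ Nat)} → P ≡SP Q → ∀̂ P ≡SP ∀̂ Q
    ∈̂-cong  : ∀ {Γ} {M M' : Tm Γ Nat} {N N' : Tm Γ SetNat} → M ≡Tm M' → N ≡Tm N' →
               (M ∈̂ N) ≡SP (M' ∈̂ N')
    ∈̂-cmp   : ∀ {Γ} {M : Tm Γ Nat} {P : SP (Γ ▸ Nat)} → (M ∈̂ cmp P) ≡SP subSP (sub0 M) P

data _≡Prp_ : ∀ {Γ} → Prp Γ → Prp Γ → Set where
  p-refl  : ∀ {Γ} {φ : Prp Γ} → φ ≡Prp φ
  p-sym   : ∀ {Γ} {φ ψ : Prp Γ} → φ ≡Prp ψ → ψ ≡Prp φ
  p-trans : ∀ {Γ} {φ ψ χ : Prp Γ} → φ ≡Prp ψ → ψ ≡Prp χ → φ ≡Prp χ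
  ≐-cong  : ∀ {Γ} {M M' N N' : Tm Γ Nat} → M ≡Tm M' → N ≡Tm N' → (M ≐ N) ≡Prp (M' ≐ N')
  ⊃-cong  : ∀ {Γ} {φ φ' ψ ψ' : Prp Γ} → φ ≡Prp φ' → ψ ≡Prp ψ' → (φ ⊃ᴾ ψ) ≡Prp (φ' ⊃ᴾ ψ')
  ∀-cong  : ∀ {Γ A} {φ ψ : Prp (Γ ▸ A)} → φ ≡Prp ψ → ∀ᴾ A φ ≡Prp ∀ᴾ A ψ
  V-cong  : ∀ {Γ} {P Q : SP Γ} → P ≡SP Q → V P ≡Prp V Q
  V-⊥     : ∀ {Γ} → V {Γ} ⊥̂ ≡Prp ⊥ᴾ
  V-⊃     : ∀ {Γ} {P Q : SP Γ} → V (P ⊃̂ Q) ≡Prp (V P ⊃ᴾ V Q)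
  V-∀     : ∀ {Γ} {P : SP (Γ ▸ Nat)} → V (∀̂ P) ≡Prp ∀ᴾ Nat (V P)
  V-=     : ∀ {Γ} {M N : Tm Γ Nat} → V (M =̂ N) ≡Prp (M ≐ N)

infix 2 _⊢_⇒_
data _⊢_⇒_ : (Γ : Ctx) → List (Prp Γ) → Prp Γ → Set where
  hyp   : ∀ {Γ Φ φ} → φ ∈ Φ → Γ ⊢ Φ ⇒ φ
  conv  : ∀ {Γ Φ φ ψ} → Γ ⊢ Φ ⇒ φ → φ ≡Prp ψ → Γ ⊢ Φ ⇒ ψ
  ⊥E    : ∀ {Γ Φ φ} → Γ ⊢ Φ ⇒ ⊥ᴾ → Γ ⊢ Φ ⇒ φ
  ⊃I    : ∀ {Γ Φ φ ψ} → Γ ⊢ φ ∷ Φ ⇒ ψ → Γ ⊢ Φ ⇒ φ ⊃ᴾ ψ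
  ⊃E    : ∀ {Γ Φ φ ψ} → Γ ⊢ Φ ⇒ φ ⊃ᴾ ψ → Γ ⊢ Φ ⇒ φ → Γ ⊢ Φ ⇒ ψ
  dne   : ∀ {Γ Φ φ} → Γ ⊢ Φ ⇒ ¬ᴾ ¬ᴾ φ → Γ ⊢ Φ ⇒ φ
  ∀I    : ∀ {Γ Φ A φ} → Γ ▸ A ⊢ map wkPrp Φ ⇒ φ → Γ ⊢ Φ ⇒ ∀ᴾ A φ
  ∀E    : ∀ {Γ Φ A φ} → Γ ⊢ Φ ⇒ ∀ᴾ A φ → (M : Tm Γ A) → Γ ⊢ Φ ⇒ subPrp (sub0 M) φ
  eqRefl  : ∀ {Γ Φ} {M : Tm Γ Nat} → Γ ⊢ Φ ⇒ M ≐ M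
  eqSubst : ∀ {Γ Φ} {M₁ M₂ : Tm Γ Nat} (φ : Prp (Γ ▸ Nat)) →
            Γ ⊢ Φ ⇒ M₁ ≐ M₂ → Γ ⊢ Φ ⇒ subPrp (sub0 M₁) φ → Γ ⊢ Φ ⇒ subPrp (sub0 M₂) φ
  ind   : ∀ {Γ Φ} (P : SP (Γ ▸ Nat)) (N : Tm Γ Nat) →
          Γ ⊢ Φ ⇒ V (subSP (sub0 zer) P) →
          Γ ▸ Nat ⊢ V P ∷ map wkPrp Φ ⇒ V (subSP subSucc P) →
          Γ ⊢ Φ ⇒ V (subSP (sub0 N) P)
  0≢s   : ∀ {Γ Φ} (M : Tm Γ Nat) → Γ ⊢ Φ ⇒ ¬ᴾ (zer ≐ sc M)

_plus_ : ∀ {Γ} → Tm Γ Nat → Tm Γ Nat → Tm Γ Nat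
M plus N = R M (sc (var here)) N

_times_ : ∀ {Γ} → Tm Γ Nat → Tm Γ Nat → Tm Γ Nat
M times N = R zer (var here plus renTm (λ x → there (there x)) M) N

trT : ∀ {m Γ} → (Fin m → Γ ∋ Nat) → Term m → Tm Γ Nat
trT ρ (avar i) = var (ρ i)
trT ρ `0 = zer
trT ρ (`S t) = sc (trT ρ t)
trT ρ (s `+ t) = trT ρ s plus trT ρ t
trT ρ (s `· t) = trT ρ s times trT ρ t

extEnv : ∀ {k Γ A} → (Fin k → Γ ∋ A) → Fin (suc k) → Γ ▸ A ∋ A
extEnv ρ zero = here
extEnv ρ (suc i) = there (ρ i)

trF : ∀ {m n Γ} → (Fin m → Γ ∋ Nat) → (Fin n → Γ ∋ SetNat) → Form m n → Prp Γ
trF ρ σ (s `≡ t) = trT ρ s ≐ trT ρ t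
trF ρ σ (t `∈ X) = V (trT ρ t ∈̂ var (σ X))
trF ρ σ `⊥ = ⊥ᴾ
trF ρ σ (φ `⊃ ψ) = trF ρ σ φ ⊃ᴾ trF ρ σ ψ
trF ρ σ (`∀ φ) = ∀ᴾ Nat (trF (extEnv ρ) (λ j → there (σ j)) φ)
trF ρ σ (`∀² φ) = ∀ᴾ SetNat (trF (λ i → there (ρ i)) (extEnv σ) φ)

numCtx : ℕ → Ctx
numCtx zero = ε
numCtx (suc m) = numCtx m ▸ Nat

ctxΓ : ℕ → ℕ → Ctx
ctxΓ m zero = numCtx m
ctxΓ m (suc n) = ctxΓ m n ▸ SetNat

numVar : (m : ℕ) → Fin m → numCtx m ∋ Nat
numVar (suc m) zero = here
numVar (suc m) (suc i) = there (numVar m i)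

numEnv : (m n : ℕ) → Fin m → ctxΓ m n ∋ Nat
numEnv m zero i = numVar m i
numEnv m (suc n) i = there (numEnv m n i)

setEnv : (m n : ℕ) → Fin n → ctxΓ m n ∋ SetNat
setEnv m (suc n) zero = here
setEnv m (suc n) (suc j) = there (setEnv m n j)

⟨_⟩ : ∀ {m n} → Form m n → Prp (ctxΓ m n)
⟨_⟩ {m} {n} φ = trF (numEnv m n) (setEnv m n) φ

module Submission where

-- The proof is a soundness argument by induction on ACA₀-derivations.  To make
-- the induction go through, the translation is generalised from variables to
-- arbitrary T₂-terms: trPrp ρ σ φ interprets the number variables of φ by the
-- terms ρ i : ℕ and the set variables by σ j : Set(ℕ).

open import Data.Nat using (ℕ; suc)
open import Data.Fin using (Fin; zero; suc)
open import Data.List using (List; []; _∷_; map)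
open import Data.List.Properties using (map-∘; map-cong)
open import Data.List.Relation.Unary.Any using (here; there)
open import Data.List.Membership.Propositional.Properties using (∈-map⁺)
open import Relation.Binary.PropositionalEquality using (_≡_; refl; sym; trans; cong; cong₂; subst)
open import Defs

cong₃ : ∀ {A B C D : Set} (f : A → B → C → D) {a a' b b' c c'} →
        a ≡ a' → b ≡ b' → c ≡ c' → f a b c ≡ f a' b' c'
cong₃ f refl refl refl = refl

wkT : ∀ {Γ A B} → Tm Γ A → Tm (Γ ▸ B) A
wkT = renTm there

liftRen-fuse : ∀ {Γ Δ Θ B} {ρ₁ : Ren Δ Θ} {ρ₂ : Ren Γ Δ} {ρ₃ : Ren Γ Θ} →
  (∀ {A} (x : Γ ∋ A) → ρ₁ (ρ₂ x) ≡ ρ₃ x) →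
  ∀ {A} (x : Γ ▸ B ∋ A) → liftRen ρ₁ (liftRen ρ₂ x) ≡ liftRen ρ₃ x
liftRen-fuse h here = refl
liftRen-fuse h (there x) = cong there (h x)

mutual
  renTm-renTm : ∀ {Γ Δ Θ} {ρ₁ : Ren Δ Θ} {ρ₂ : Ren Γ Δ} {ρ₃ : Ren Γ Θ} →
    (∀ {A} (x : Γ ∋ A) → ρ₁ (ρ₂ x) ≡ ρ₃ x) →
    ∀ {A} (M : Tm Γ A) → renTm ρ₁ (renTm ρ₂ M) ≡ renTm ρ₃ M
  renTm-renTm h (var x) = cong var (h x)
  renTm-renTm h zer = refl
  renTm-renTm h (sc M) = cong sc (renTm-renTm h M)
  renTm-renTm h (R L M N) =
    cong₃ R (renTm-renTm h L) (renTm-renTm (liftRen-fuse (liftRen-fuse h)) M) (renTm-renTm h N)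
  renTm-renTm h (cmp P) = cong cmp (renSP-renSP (liftRen-fuse h) P)

  renSP-renSP : ∀ {Γ Δ Θ} {ρ₁ : Ren Δ Θ} {ρ₂ : Ren Γ Δ} {ρ₃ : Ren Γ Θ} →
    (∀ {A} (x : Γ ∋ A) → ρ₁ (ρ₂ x) ≡ ρ₃ x) →
    (P : SP Γ) → renSP ρ₁ (renSP ρ₂ P) ≡ renSP ρ₃ P
  renSP-renSP h (M =̂ N) = cong₂ _=̂_ (renTm-renTm h M) (renTm-renTm h N)
  renSP-renSP h ⊥̂ = refl
  renSP-renSP h (P ⊃̂ Q) = cong₂ _⊃̂_ (renSP-renSP h P) (renSP-renSP h Q)
  renSP-renSP h (∀̂ P) = cong ∀̂ (renSP-renSP (liftRen-fuse h) P)
  renSP-renSP h (M ∈̂ N) = cong₂ _∈̂_ (renTm-renTm h M) (renTm-renTm h N)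

liftRen-wk : ∀ {Γ Δ B} (θ : Ren Γ Δ) {A} (M : Tm Γ A) →
             renTm (liftRen {B = B} θ) (wkT M) ≡ wkT (renTm θ M)
liftRen-wk θ M = trans (renTm-renTm (λ _ → refl) M) (sym (renTm-renTm (λ _ → refl) M))

liftSub-liftRen : ∀ {Γ Δ Θ B} {σ : Sub Δ Θ} {ρ : Ren Γ Δ} {τ : Sub Γ Θ} →
  (∀ {A} (x : Γ ∋ A) → σ (ρ x) ≡ τ x) →
  ∀ {A} (x : Γ ▸ B ∋ A) → liftSub σ (liftRen ρ x) ≡ liftSub τ x
liftSub-liftRen h here = refl
liftSub-liftRen h (there x) = cong wkT (h x)

mutual
  subTm-renTm : ∀ {Γ Δ Θ} {σ : Sub Δ Θ} {ρ : Ren Γ Δ} {τ : Sub Γ Θ} →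
    (∀ {A} (x : Γ ∋ A) → σ (ρ x) ≡ τ x) →
    ∀ {A} (M : Tm Γ A) → subTm σ (renTm ρ M) ≡ subTm τ M
  subTm-renTm h (var x) = h x
  subTm-renTm h zer = refl
  subTm-renTm h (sc M) = cong sc (subTm-renTm h M)
  subTm-renTm h (R L M N) =
    cong₃ R (subTm-renTm h L) (subTm-renTm (liftSub-liftRen (liftSub-liftRen h)) M) (subTm-renTm h N)
  subTm-renTm h (cmp P) = cong cmp (subSP-renSP (liftSub-liftRen h) P)

  subSP-renSP : ∀ {Γ Δ Θ} {σ : Sub Δ Θ} {ρ : Ren Γ Δ} {τ : Sub Γ Θ} →
    (∀ {A} (x : Γ ∋ A) → σ (ρ x) ≡ τ x) →
    (P : SP Γ) → subSP σ (renSP ρ P) ≡ subSP τ P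
  subSP-renSP h (M =̂ N) = cong₂ _=̂_ (subTm-renTm h M) (subTm-renTm h N)
  subSP-renSP h ⊥̂ = refl
  subSP-renSP h (P ⊃̂ Q) = cong₂ _⊃̂_ (subSP-renSP h P) (subSP-renSP h Q)
  subSP-renSP h (∀̂ P) = cong ∀̂ (subSP-renSP (liftSub-liftRen h) P)
  subSP-renSP h (M ∈̂ N) = cong₂ _∈̂_ (subTm-renTm h M) (subTm-renTm h N)

liftRen-liftSub : ∀ {Γ Δ Θ B} {ρ : Ren Δ Θ} {σ : Sub Γ Δ} {τ : Sub Γ Θ} →
  (∀ {A} (x : Γ ∋ A) → renTm ρ (σ x) ≡ τ x) →
  ∀ {A} (x : Γ ▸ B ∋ A) → renTm (liftRen ρ) (liftSub σ x) ≡ liftSub τ x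
liftRen-liftSub h here = refl
liftRen-liftSub {ρ = ρ} {σ = σ} h (there x) = trans (liftRen-wk ρ (σ x)) (cong wkT (h x))

mutual
  renTm-subTm : ∀ {Γ Δ Θ} {ρ : Ren Δ Θ} {σ : Sub Γ Δ} {τ : Sub Γ Θ} →
    (∀ {A} (x : Γ ∋ A) → renTm ρ (σ x) ≡ τ x) →
    ∀ {A} (M : Tm Γ A) → renTm ρ (subTm σ M) ≡ subTm τ M
  renTm-subTm h (var x) = h x
  renTm-subTm h zer = refl
  renTm-subTm h (sc M) = cong sc (renTm-subTm h M)
  renTm-subTm h (R L M N) =
    cong₃ R (renTm-subTm h L) (renTm-subTm (liftRen-liftSub (liftRen-liftSub h)) M) (renTm-subTm h N)
  renTm-subTm h (cmp P) = cong cmp (renSP-subSP (liftRen-liftSub h) P)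

  renSP-subSP : ∀ {Γ Δ Θ} {ρ : Ren Δ Θ} {σ : Sub Γ Δ} {τ : Sub Γ Θ} →
    (∀ {A} (x : Γ ∋ A) → renTm ρ (σ x) ≡ τ x) →
    (P : SP Γ) → renSP ρ (subSP σ P) ≡ subSP τ P
  renSP-subSP h (M =̂ N) = cong₂ _=̂_ (renTm-subTm h M) (renTm-subTm h N)
  renSP-subSP h ⊥̂ = refl
  renSP-subSP h (P ⊃̂ Q) = cong₂ _⊃̂_ (renSP-subSP h P) (renSP-subSP h Q)
  renSP-subSP h (∀̂ P) = cong ∀̂ (renSP-subSP (liftRen-liftSub h) P)
  renSP-subSP h (M ∈̂ N) = cong₂ _∈̂_ (renTm-subTm h M) (renTm-subTm h N)

liftSub-id : ∀ {Γ B} {σ : Sub Γ Γ} → (∀ {A} (x : Γ ∋ A) → σ x ≡ var x) →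
             ∀ {A} (x : Γ ▸ B ∋ A) → liftSub σ x ≡ var x
liftSub-id h here = refl
liftSub-id h (there x) = cong wkT (h x)

mutual
  subTm-id : ∀ {Γ} {σ : Sub Γ Γ} → (∀ {A} (x : Γ ∋ A) → σ x ≡ var x) →
             ∀ {A} (M : Tm Γ A) → subTm σ M ≡ M
  subTm-id h (var x) = h x
  subTm-id h zer = refl
  subTm-id h (sc M) = cong sc (subTm-id h M)
  subTm-id h (R L M N) = cong₃ R (subTm-id h L) (subTm-id (liftSub-id (liftSub-id h)) M) (subTm-id h N)
  subTm-id h (cmp P) = cong cmp (subSP-id (liftSub-id h) P)

  subSP-id : ∀ {Γ} {σ : Sub Γ Γ} → (∀ {A} (x : Γ ∋ A) → σ x ≡ var x) → (P : SP Γ) → subSP σ P ≡ P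
  subSP-id h (M =̂ N) = cong₂ _=̂_ (subTm-id h M) (subTm-id h N)
  subSP-id h ⊥̂ = refl
  subSP-id h (P ⊃̂ Q) = cong₂ _⊃̂_ (subSP-id h P) (subSP-id h Q)
  subSP-id h (∀̂ P) = cong ∀̂ (subSP-id (liftSub-id h) P)
  subSP-id h (M ∈̂ N) = cong₂ _∈̂_ (subTm-id h M) (subTm-id h N)

sub0-wk : ∀ {Γ A B} (N : Tm Γ B) (M : Tm Γ A) → subTm (sub0 N) (wkT M) ≡ M
sub0-wk N M = trans (subTm-renTm (λ _ → refl) M) (subTm-id (λ _ → refl) M)

liftSub-wk : ∀ {Γ Δ B} (θ : Sub Γ Δ) {A} (M : Tm Γ A) →
             subTm (liftSub {B = B} θ) (wkT M) ≡ wkT (subTm θ M)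
liftSub-wk θ M = trans (subTm-renTm (λ _ → refl) M) (sym (renTm-subTm (λ _ → refl) M))

-- `times` weakens its left argument past two binders, so it commutes with
-- renaming and substitution only up to the fusion laws above.
renTm-times : ∀ {Γ Δ} (θ : Ren Γ Δ) (M N : Tm Γ Nat) →
              renTm θ (M times N) ≡ renTm θ M times renTm θ N
renTm-times θ M N = cong (λ K → R zer (var here plus K) (renTm θ N))
  (trans (renTm-renTm (λ _ → refl) M) (sym (renTm-renTm (λ _ → refl) M)))

subTm-times : ∀ {Γ Δ} (θ : Sub Γ Δ) (M N : Tm Γ Nat) →
              subTm θ (M times N) ≡ subTm θ M times subTm θ N
subTm-times θ M N = cong (λ K → R zer (var here plus K) (subTm θ N))
  (trans (subTm-renTm {τ = λ x → renTm (λ y → there (there y)) (θ x)}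
                      (λ x → renTm-renTm (λ _ → refl) (θ x)) M)
         (sym (renTm-subTm (λ _ → refl) M)))

Env : ℕ → Ctx → Ty → Set
Env k Γ A = Fin k → Tm Γ A

liftEnv : ∀ {k Γ A} → Env k Γ A → Env (suc k) (Γ ▸ A) A
liftEnv ρ zero = var here
liftEnv ρ (suc i) = wkT (ρ i)

wkEnv : ∀ {k Γ A B} → Env k Γ A → Env k (Γ ▸ B) A
wkEnv ρ i = wkT (ρ i)

trTm : ∀ {m Γ} → Env m Γ Nat → Term m → Tm Γ Nat
trTm ρ (avar i) = ρ i
trTm ρ `0 = zer
trTm ρ (`S t) = sc (trTm ρ t)
trTm ρ (s `+ t) = trTm ρ s plus trTm ρ t
trTm ρ (s `· t) = trTm ρ s times trTm ρ t

trPrp : ∀ {m n Γ} → Env m Γ Nat → Env n Γ SetNat → Form m n → Prp Γ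
trPrp ρ σ (s `≡ t) = trTm ρ s ≐ trTm ρ t
trPrp ρ σ (t `∈ X) = V (trTm ρ t ∈̂ σ X)
trPrp ρ σ `⊥ = ⊥ᴾ
trPrp ρ σ (φ `⊃ ψ) = trPrp ρ σ φ ⊃ᴾ trPrp ρ σ ψ
trPrp ρ σ (`∀ φ) = ∀ᴾ Nat (trPrp (liftEnv ρ) (wkEnv σ) φ)
trPrp ρ σ (`∀² φ) = ∀ᴾ SetNat (trPrp (wkEnv ρ) (liftEnv σ) φ)

trTm-renT : ∀ {m m' Γ} {ρ : Env m' Γ Nat} {r : Fin m → Fin m'} {ρ' : Env m Γ Nat} →
  (∀ i → ρ (r i) ≡ ρ' i) → (t : Term m) → trTm ρ (renT r t) ≡ trTm ρ' t
trTm-renT h (avar i) = h i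
trTm-renT h `0 = refl
trTm-renT h (`S t) = cong sc (trTm-renT h t)
trTm-renT h (s `+ t) = cong₂ _plus_ (trTm-renT h s) (trTm-renT h t)
trTm-renT h (s `· t) = cong₂ _times_ (trTm-renT h s) (trTm-renT h t)

trTm-subT : ∀ {m m' Γ} {ρ : Env m' Γ Nat} {s : Fin m → Term m'} {ρ' : Env m Γ Nat} →
  (∀ i → trTm ρ (s i) ≡ ρ' i) → (t : Term m) → trTm ρ (subT s t) ≡ trTm ρ' t
trTm-subT h (avar i) = h i
trTm-subT h `0 = refl
trTm-subT h (`S t) = cong sc (trTm-subT h t)
trTm-subT h (s `+ t) = cong₂ _plus_ (trTm-subT h s) (trTm-subT h t)
trTm-subT h (s `· t) = cong₂ _times_ (trTm-subT h s) (trTm-subT h t)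

renTm-trTm : ∀ {m Γ Δ} (θ : Ren Γ Δ) {ρ : Env m Γ Nat} {ρ' : Env m Δ Nat} →
  (∀ i → renTm θ (ρ i) ≡ ρ' i) → (t : Term m) → renTm θ (trTm ρ t) ≡ trTm ρ' t
renTm-trTm θ h (avar i) = h i
renTm-trTm θ h `0 = refl
renTm-trTm θ h (`S t) = cong sc (renTm-trTm θ h t)
renTm-trTm θ h (s `+ t) = cong₂ _plus_ (renTm-trTm θ h s) (renTm-trTm θ h t)
renTm-trTm θ {ρ} h (s `· t) =
  trans (renTm-times θ (trTm ρ s) (trTm ρ t)) (cong₂ _times_ (renTm-trTm θ h s) (renTm-trTm θ h t))

subTm-trTm : ∀ {m Γ Δ} (θ : Sub Γ Δ) {ρ : Env m Γ Nat} {ρ' : Env m Δ Nat} →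
  (∀ i → subTm θ (ρ i) ≡ ρ' i) → (t : Term m) → subTm θ (trTm ρ t) ≡ trTm ρ' t
subTm-trTm θ h (avar i) = h i
subTm-trTm θ h `0 = refl
subTm-trTm θ h (`S t) = cong sc (subTm-trTm θ h t)
subTm-trTm θ h (s `+ t) = cong₂ _plus_ (subTm-trTm θ h s) (subTm-trTm θ h t)
subTm-trTm θ {ρ} h (s `· t) =
  trans (subTm-times θ (trTm ρ s) (trTm ρ t)) (cong₂ _times_ (subTm-trTm θ h s) (subTm-trTm θ h t))

renTm-liftEnv : ∀ {k Γ Δ A} (θ : Ren Γ Δ) {ρ : Env k Γ A} {ρ' : Env k Δ A} →
  (∀ i → renTm θ (ρ i) ≡ ρ' i) → ∀ i → renTm (liftRen θ) (liftEnv ρ i) ≡ liftEnv ρ' i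
renTm-liftEnv θ h zero = refl
renTm-liftEnv θ {ρ} h (suc i) = trans (liftRen-wk θ (ρ i)) (cong wkT (h i))

subTm-liftEnv : ∀ {k Γ Δ A} (θ : Sub Γ Δ) {ρ : Env k Γ A} {ρ' : Env k Δ A} →
  (∀ i → subTm θ (ρ i) ≡ ρ' i) → ∀ i → subTm (liftSub θ) (liftEnv ρ i) ≡ liftEnv ρ' i
subTm-liftEnv θ h zero = refl
subTm-liftEnv θ {ρ} h (suc i) = trans (liftSub-wk θ (ρ i)) (cong wkT (h i))

renPrp-trPrp : ∀ {m n Γ Δ} (θ : Ren Γ Δ) {ρ : Env m Γ Nat} {ρ' : Env m Δ Nat}
  {σ : Env n Γ SetNat} {σ' : Env n Δ SetNat} →
  (∀ i → renTm θ (ρ i) ≡ ρ' i) → (∀ j → renTm θ (σ j) ≡ σ' j) →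
  (φ : Form m n) → renPrp θ (trPrp ρ σ φ) ≡ trPrp ρ' σ' φ
renPrp-trPrp θ h g (s `≡ t) = cong₂ _≐_ (renTm-trTm θ h s) (renTm-trTm θ h t)
renPrp-trPrp θ h g (t `∈ X) = cong V (cong₂ _∈̂_ (renTm-trTm θ h t) (g X))
renPrp-trPrp θ h g `⊥ = refl
renPrp-trPrp θ h g (φ `⊃ ψ) = cong₂ _⊃ᴾ_ (renPrp-trPrp θ h g φ) (renPrp-trPrp θ h g ψ)
renPrp-trPrp θ {σ = σ} h g (`∀ φ) = cong (∀ᴾ Nat)
  (renPrp-trPrp (liftRen θ) (renTm-liftEnv θ h) (λ j → trans (liftRen-wk θ (σ j)) (cong wkT (g j))) φ)
renPrp-trPrp θ {ρ = ρ} h g (`∀² φ) = cong (∀ᴾ SetNat)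
  (renPrp-trPrp (liftRen θ) (λ i → trans (liftRen-wk θ (ρ i)) (cong wkT (h i))) (renTm-liftEnv θ g) φ)

subPrp-trPrp : ∀ {m n Γ Δ} (θ : Sub Γ Δ) {ρ : Env m Γ Nat} {ρ' : Env m Δ Nat}
  {σ : Env n Γ SetNat} {σ' : Env n Δ SetNat} →
  (∀ i → subTm θ (ρ i) ≡ ρ' i) → (∀ j → subTm θ (σ j) ≡ σ' j) →
  (φ : Form m n) → subPrp θ (trPrp ρ σ φ) ≡ trPrp ρ' σ' φ
subPrp-trPrp θ h g (s `≡ t) = cong₂ _≐_ (subTm-trTm θ h s) (subTm-trTm θ h t)
subPrp-trPrp θ h g (t `∈ X) = cong V (cong₂ _∈̂_ (subTm-trTm θ h t) (g X))
subPrp-trPrp θ h g `⊥ = refl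
subPrp-trPrp θ h g (φ `⊃ ψ) = cong₂ _⊃ᴾ_ (subPrp-trPrp θ h g φ) (subPrp-trPrp θ h g ψ)
subPrp-trPrp θ {σ = σ} h g (`∀ φ) = cong (∀ᴾ Nat)
  (subPrp-trPrp (liftSub θ) (subTm-liftEnv θ h) (λ j → trans (liftSub-wk θ (σ j)) (cong wkT (g j))) φ)
subPrp-trPrp θ {ρ = ρ} h g (`∀² φ) = cong (∀ᴾ SetNat)
  (subPrp-trPrp (liftSub θ) (λ i → trans (liftSub-wk θ (ρ i)) (cong wkT (h i))) (subTm-liftEnv θ g) φ)

trPrp-subF : ∀ {m m' n n' Γ} {ρ : Env m' Γ Nat} {σ : Env n' Γ SetNat}
  {s : Fin m → Term m'} {τ : Fin n → Fin n'} {ρ' : Env m Γ Nat} {σ' : Env n Γ SetNat} →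
  (∀ i → trTm ρ (s i) ≡ ρ' i) → (∀ j → σ (τ j) ≡ σ' j) →
  (φ : Form m n) → trPrp ρ σ (subF s τ φ) ≡ trPrp ρ' σ' φ
trPrp-subF h g (s `≡ t) = cong₂ _≐_ (trTm-subT h s) (trTm-subT h t)
trPrp-subF h g (t `∈ X) = cong V (cong₂ _∈̂_ (trTm-subT h t) (g X))
trPrp-subF h g `⊥ = refl
trPrp-subF h g (φ `⊃ ψ) = cong₂ _⊃ᴾ_ (trPrp-subF h g φ) (trPrp-subF h g ψ)
trPrp-subF {ρ = ρ} {s = s} h g (`∀ φ) = cong (∀ᴾ Nat) (trPrp-subF lifted (λ j → cong wkT (g j)) φ)
  where
  lifted : ∀ i → trTm (liftEnv ρ) (liftT s i) ≡ liftEnv _ i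
  lifted zero = refl
  lifted (suc i) = trans (trTm-renT (λ _ → refl) (s i))
                         (trans (sym (renTm-trTm there (λ _ → refl) (s i))) (cong wkT (h i)))
trPrp-subF {ρ = ρ} {s = s} h g (`∀² φ) = cong (∀ᴾ SetNat)
  (trPrp-subF (λ i → trans (sym (renTm-trTm there (λ _ → refl) (s i))) (cong wkT (h i))) lifted φ)
  where
  lifted : ∀ j → liftEnv _ (liftF _ j) ≡ liftEnv _ j
  lifted zero = refl
  lifted (suc j) = cong wkT (g j)

trPrp-wkN : ∀ {m n Γ} (ρ : Env m Γ Nat) (σ : Env n Γ SetNat) (ψ : Form m n) →
            trPrp (liftEnv ρ) (wkEnv σ) (wkN ψ) ≡ wkPrp (trPrp ρ σ ψ)
trPrp-wkN ρ σ ψ =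
  trans (trPrp-subF (λ _ → refl) (λ _ → refl) ψ) (sym (renPrp-trPrp there (λ _ → refl) (λ _ → refl) ψ))

trPrp-wkS : ∀ {m n Γ} (ρ : Env m Γ Nat) (σ : Env n Γ SetNat) (ψ : Form m n) →
            trPrp (wkEnv ρ) (liftEnv σ) (wkS ψ) ≡ wkPrp (trPrp ρ σ ψ)
trPrp-wkS ρ σ ψ =
  trans (trPrp-subF (λ _ → refl) (λ _ → refl) ψ) (sym (renPrp-trPrp there (λ _ → refl) (λ _ → refl) ψ))

trPrp-inst : ∀ {m n Γ} (ρ : Env m Γ Nat) (σ : Env n Γ SetNat) (φ : Form (suc m) n) (t : Term m) →
  subPrp (sub0 (trTm ρ t)) (trPrp (liftEnv ρ) (wkEnv σ) φ) ≡ trPrp ρ σ (φ [ t ])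
trPrp-inst ρ σ φ t =
  trans (subPrp-trPrp (sub0 (trTm ρ t)) {ρ' = ρt} atLifted (λ j → sub0-wk _ (σ j)) φ)
        (sym (trPrp-subF (λ { zero → refl ; (suc i) → refl }) (λ _ → refl) φ))
  where
  ρt : Env (suc _) _ Nat
  ρt zero = trTm ρ t
  ρt (suc i) = ρ i
  atLifted : ∀ i → subTm (sub0 (trTm ρ t)) (liftEnv ρ i) ≡ ρt i
  atLifted zero = refl
  atLifted (suc i) = sub0-wk _ (ρ i)

trPrp-inst² : ∀ {m n Γ} (ρ : Env m Γ Nat) (σ : Env n Γ SetNat) (φ : Form m (suc n)) (Y : Fin n) →
  subPrp (sub0 (σ Y)) (trPrp (wkEnv ρ) (liftEnv σ) φ) ≡ trPrp ρ σ (φ [² Y ])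
trPrp-inst² ρ σ φ Y =
  trans (subPrp-trPrp (sub0 (σ Y)) {σ' = σY} (λ i → sub0-wk _ (ρ i)) atLifted φ)
        (sym (trPrp-subF (λ _ → refl) (λ { zero → refl ; (suc j) → refl }) φ))
  where
  σY : Env (suc _) _ SetNat
  σY zero = σ Y
  σY (suc j) = σ j
  atLifted : ∀ j → subTm (sub0 (σ Y)) (liftEnv σ j) ≡ σY j
  atLifted zero = refl
  atLifted (suc j) = sub0-wk _ (σ j)

-- An arithmetic formula translates to a small proposition P with V(P) = ⟨φ⟩;
-- this is what lets comprehension and induction apply to it.
trSP : ∀ {m n Γ} (ρ : Env m Γ Nat) (σ : Env n Γ SetNat) {φ : Form m n} → Arithmetic φ → SP Γ
trSP ρ σ (ar-eq {s = s} {t = t}) = trTm ρ s =̂ trTm ρ t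
trSP ρ σ (ar-mem {t = t} {X = X}) = trTm ρ t ∈̂ σ X
trSP ρ σ ar-bot = ⊥̂
trSP ρ σ (ar-imp a b) = trSP ρ σ a ⊃̂ trSP ρ σ b
trSP ρ σ (ar-all a) = ∀̂ (trSP (liftEnv ρ) (wkEnv σ) a)

V-trSP : ∀ {m n Γ} (ρ : Env m Γ Nat) (σ : Env n Γ SetNat) {φ : Form m n} (a : Arithmetic φ) →
         V (trSP ρ σ a) ≡Prp trPrp ρ σ φ
V-trSP ρ σ ar-eq = V-=
V-trSP ρ σ ar-mem = p-refl
V-trSP ρ σ ar-bot = V-⊥
V-trSP ρ σ (ar-imp a b) = p-trans V-⊃ (⊃-cong (V-trSP ρ σ a) (V-trSP ρ σ b))
V-trSP ρ σ (ar-all a) = p-trans V-∀ (∀-cong (V-trSP (liftEnv ρ) (wkEnv σ) a))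

≡⇒≡Prp : ∀ {Γ} {φ ψ : Prp Γ} → φ ≡ ψ → φ ≡Prp ψ
≡⇒≡Prp refl = p-refl

castConcl : ∀ {Γ Φ} {φ ψ : Prp Γ} → φ ≡ ψ → Γ ⊢ Φ ⇒ φ → Γ ⊢ Φ ⇒ ψ
castConcl refl d = d

≐-sym : ∀ {Γ Φ} {M N : Tm Γ Nat} → Γ ⊢ Φ ⇒ M ≐ N → Γ ⊢ Φ ⇒ N ≐ M
≐-sym {M = M} {N = N} d =
  castConcl (cong (N ≐_) (sub0-wk N M))
    (eqSubst (var here ≐ wkT M) d (castConcl (cong (M ≐_) (sym (sub0-wk M M))) eqRefl))

≐-congTm : ∀ {Γ Φ} {M N : Tm Γ Nat} (K : Tm (Γ ▸ Nat) Nat) → Γ ⊢ Φ ⇒ M ≐ N →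
         Γ ⊢ Φ ⇒ subTm (sub0 M) K ≐ subTm (sub0 N) K
≐-congTm {M = M} {N = N} K d =
  castConcl (cong (_≐ KN) (sub0-wk N KM))
    (eqSubst (wkT KM ≐ K) d (castConcl (cong (_≐ KM) (sym (sub0-wk M KM))) eqRefl))
  where
  KM = subTm (sub0 M) K
  KN = subTm (sub0 N) K

≡Prp⇒↔ : ∀ {Γ Φ} {φ ψ : Prp Γ} → φ ≡Prp ψ →
         Γ ⊢ Φ ⇒ ((φ ⊃ᴾ ψ) ⊃ᴾ ((ψ ⊃ᴾ φ) ⊃ᴾ ⊥ᴾ)) ⊃ᴾ ⊥ᴾ
≡Prp⇒↔ e = ⊃I (⊃E (⊃E (hyp (here refl)) (⊃I (conv (hyp (here refl)) e)))
                     (⊃I (conv (hyp (here refl)) (p-sym e))))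

predTm : ∀ {Γ} → Tm (Γ ▸ Nat) Nat
predTm = R zer (var (there here)) (var here)

-- Comprehension: the witness for ∃X ∀x (x ∈ X ↔ φ) is the T₂-set {x : ℕ | P},
-- where P is the small proposition translating the arithmetic formula φ.
comprehensionSound : ∀ {m n Γ} (φ : Form (suc m) n) (a : Arithmetic φ)
  (ρ : Env m Γ Nat) (σ : Env n Γ SetNat) (Φ : List (Prp Γ)) →
  Γ ⊢ Φ ⇒ trPrp ρ σ (`∃² (`∀ ((avar zero `∈ zero) `↔ wkS φ)))
comprehensionSound {m} {n} {Γ} φ a ρ σ Φ = ⊃I (⊃E refute (∀I (≡Prp⇒↔ memberIff)))
  where
  P : SP (Γ ▸ Nat)
  P = trSP (liftEnv ρ) (wkEnv σ) a
  C : Tm Γ SetNat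
  C = cmp P
  σC : Env (suc n) Γ SetNat
  σC zero = C
  σC (suc j) = σ j
  spec : Form m (suc n)
  spec = `∀ ((avar zero `∈ zero) `↔ wkS φ)
  -- instantiating the refuted ∀X ¬spec at X := C
  refute : Γ ⊢ trPrp ρ σ (`∀² (`¬ spec)) ∷ Φ ⇒ trPrp ρ σC spec ⊃ᴾ ⊥ᴾ
  refute = castConcl (cong (_⊃ᴾ ⊥ᴾ) (subPrp-trPrp (sub0 C) (λ i → sub0-wk C (ρ i))
                                     (λ { zero → refl ; (suc j) → sub0-wk C (σ j) }) spec))
             (∀E (hyp (here refl)) C)
  -- x ∈ {x | P} = P, and V(P) = ⟨φ⟩
  unlift : ∀ {A} (x : Γ ▸ Nat ∋ A) → sub0 (var here) (liftRen there x) ≡ var x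
  unlift here = refl
  unlift (there x) = refl
  memberIff : V (var here ∈̂ wkT C) ≡Prp trPrp (liftEnv ρ) (wkEnv σC) (wkS φ)
  memberIff = p-trans (V-cong ∈̂-cmp)
    (p-trans (≡⇒≡Prp (cong V (trans (subSP-renSP unlift P) (subSP-id (λ _ → refl) P))))
    (p-trans (V-trSP (liftEnv ρ) (wkEnv σ) a)
             (≡⇒≡Prp (sym (trPrp-subF (λ _ → refl) (λ _ → refl) φ)))))

axiomSound : ∀ {m n} {φ : Form m n} → Axiom φ →
  ∀ {Γ} (ρ : Env m Γ Nat) (σ : Env n Γ SetNat) (Φ : List (Prp Γ)) → Γ ⊢ Φ ⇒ trPrp ρ σ φ
axiomSound ax-S≢0 ρ σ Φ = ∀I (⊃I (⊃E (0≢s (var here)) (≐-sym (hyp (here refl)))))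
-- s x = s y gives pred (s x) = pred (s y), which computes to x = y
axiomSound ax-Sinj ρ σ Φ = ∀I (∀I (⊃I (conv (≐-congTm predTm (hyp (here refl))) (≐-cong R-suc R-suc))))
axiomSound ax-+0 ρ σ Φ = ∀I (conv eqRefl (≐-cong (tm-sym R-zero) tm-refl))
axiomSound ax-+S ρ σ Φ = ∀I (∀I (conv eqRefl (≐-cong (tm-sym R-suc) tm-refl)))
axiomSound ax-·0 ρ σ Φ = ∀I (conv eqRefl (≐-cong (tm-sym R-zero) tm-refl))
axiomSound ax-·S ρ σ Φ = ∀I (∀I (conv eqRefl (≐-cong (tm-sym R-suc) tm-refl)))
axiomSound (ax-comp φ a) ρ σ Φ = comprehensionSound φ a ρ σ Φ
-- induction for the small proposition  x ∈̂ X
axiomSound ax-ind ρ σ Φ =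
  ∀I (⊃I (⊃I (∀I (ind (var here ∈̂ var (there (there here))) (var here)
     (hyp (there (here refl)))
     (⊃E (∀E (hyp (there (here refl))) (var here)) (hyp (here refl)))))))

map-square : ∀ {A B C D : Set} {f : B → C} {g : A → B} {h : D → C} {k : A → D} →
             (∀ x → f (g x) ≡ h (k x)) → ∀ xs → map f (map g xs) ≡ map h (map k xs)
map-square e xs = trans (sym (map-∘ xs)) (trans (map-cong e xs) (map-∘ xs))

sound : ∀ {m n} {Δ : List (Form m n)} {φ} → Δ ⊢ᴬ φ →
        ∀ {Γ} (ρ : Env m Γ Nat) (σ : Env n Γ SetNat) → Γ ⊢ map (trPrp ρ σ) Δ ⇒ trPrp ρ σ φ
sound (hyp p) ρ σ = hyp (∈-map⁺ (trPrp ρ σ) p)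
sound (ax x) ρ σ = axiomSound x ρ σ _
sound (⊥E d) ρ σ = ⊥E (sound d ρ σ)
sound (⊃I d) ρ σ = ⊃I (sound d ρ σ)
sound (⊃E d e) ρ σ = ⊃E (sound d ρ σ) (sound e ρ σ)
sound (dne d) ρ σ = dne (sound d ρ σ)
sound {Δ = Δ} (∀I d) ρ σ =
  ∀I (subst (_ ⊢_⇒ _) (map-square (trPrp-wkN ρ σ) Δ) (sound d (liftEnv ρ) (wkEnv σ)))
sound (∀E {φ = φ} d t) ρ σ = castConcl (trPrp-inst ρ σ φ t) (∀E (sound d ρ σ) (trTm ρ t))
sound {Δ = Δ} (∀²I d) ρ σ =
  ∀I (subst (_ ⊢_⇒ _) (map-square (trPrp-wkS ρ σ) Δ) (sound d (wkEnv ρ) (liftEnv σ)))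
sound (∀²E {φ = φ} d Y) ρ σ = castConcl (trPrp-inst² ρ σ φ Y) (∀E (sound d ρ σ) (σ Y))
sound eqRefl ρ σ = eqRefl
sound (eqSubst {s = s} {t = t} φ d e) ρ σ =
  castConcl (trPrp-inst ρ σ φ t)
    (eqSubst (trPrp (liftEnv ρ) (wkEnv σ) φ) (sound d ρ σ)
      (castConcl (sym (trPrp-inst ρ σ φ s)) (sound e ρ σ)))

trT-as-trTm : ∀ {m Γ} (ρ : Fin m → Γ ∋ Nat) {ρ' : Env m Γ Nat} →
  (∀ i → var (ρ i) ≡ ρ' i) → (t : Term m) → trT ρ t ≡ trTm ρ' t
trT-as-trTm ρ h (avar i) = h i
trT-as-trTm ρ h `0 = refl
trT-as-trTm ρ h (`S t) = cong sc (trT-as-trTm ρ h t)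
trT-as-trTm ρ h (s `+ t) = cong₂ _plus_ (trT-as-trTm ρ h s) (trT-as-trTm ρ h t)
trT-as-trTm ρ h (s `· t) = cong₂ _times_ (trT-as-trTm ρ h s) (trT-as-trTm ρ h t)

liftEnv-var : ∀ {k Γ A} (ρ : Fin k → Γ ∋ A) {ρ' : Env k Γ A} →
  (∀ i → var (ρ i) ≡ ρ' i) → ∀ i → var (extEnv ρ i) ≡ liftEnv ρ' i
liftEnv-var ρ h zero = refl
liftEnv-var ρ h (suc i) = cong wkT (h i)

trF-as-trPrp : ∀ {m n Γ} (ρ : Fin m → Γ ∋ Nat) (σ : Fin n → Γ ∋ SetNat)
  {ρ' : Env m Γ Nat} {σ' : Env n Γ SetNat} →
  (∀ i → var (ρ i) ≡ ρ' i) → (∀ j → var (σ j) ≡ σ' j) →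
  (φ : Form m n) → trF ρ σ φ ≡ trPrp ρ' σ' φ
trF-as-trPrp ρ σ h g (s `≡ t) = cong₂ _≐_ (trT-as-trTm ρ h s) (trT-as-trTm ρ h t)
trF-as-trPrp ρ σ h g (t `∈ X) = cong V (cong₂ _∈̂_ (trT-as-trTm ρ h t) (g X))
trF-as-trPrp ρ σ h g `⊥ = refl
trF-as-trPrp ρ σ h g (φ `⊃ ψ) = cong₂ _⊃ᴾ_ (trF-as-trPrp ρ σ h g φ) (trF-as-trPrp ρ σ h g ψ)
trF-as-trPrp ρ σ h g (`∀ φ) = cong (∀ᴾ Nat)
  (trF-as-trPrp (extEnv ρ) (λ j → there (σ j)) (liftEnv-var ρ h) (λ j → cong wkT (g j)) φ)
trF-as-trPrp ρ σ h g (`∀² φ) = cong (∀ᴾ SetNat)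
  (trF-as-trPrp (λ i → there (ρ i)) (extEnv σ) (λ i → cong wkT (h i)) (liftEnv-var σ g) φ)

mainTheorem3 : (m n : ℕ) (φ : Form m n) → ACA₀⊢ φ → ctxΓ m n ⊢ [] ⇒ ⟨ φ ⟩
mainTheorem3 m n φ d =
  castConcl (sym (trF-as-trPrp (numEnv m n) (setEnv m n) (λ _ → refl) (λ _ → refl) φ))
    (sound d (λ i → var (numEnv m n i)) (λ j → var (setEnv m n j)))
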